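{- For every $\xi\in\mathcal{L}_{NF}$ and every game model $\mathbb{S}$, $[\![\xi]\!]^{\mathbb{S}}=[\![\xi^\sharp]\!]^{\mathbb{S}}$.
   Context: Fix countable sets $\mathsf{P}_0$, $\mathsf{G}_0$. $\mathcal{L}_{NF}$/$\mathcal{G}_{NF}$: $\varphi ::= p \mid \neg p \mid \varphi\lor\varphi \mid \varphi\land\varphi \mid \langle\gamma\rangle\varphi$, $\gamma ::= g \mid g^d \mid \gamma;\gamma \mid \gamma\sqcup\gamma \mid \gamma\sqcap\gamma \mid \gamma^* \mid \gamma^\times \mid \varphi? \mid \varphi!$. Game model $\mathbb{S}=(S,E,V)$: $V:\mathsf{P}_0\to\wp(S)$, $E(g):\wp(S)\to\wp(S)$ monotone. Game logic semantics: $[\![p]\!]=V(p)$, $[\![\neg p]\!]=S\setminus V(p)$, $\lor,\land$ as $\cup,\cap$, $[\![\langle\gamma\rangle\varphi]\!]=\hat E_\gamma([\![\varphi]\!])$, $\hat E_g=E(g)$, $\hat E_{g^d}(X)=S\setminus E(g)(S\setminus X)$, $\hat E_{\gamma;\delta}=\hat E_\gamma\circ\hat E_\delta$, $\hat E_{\gamma\sqcup\delta}(X)=\hat E_\gamma(X)\cup\hat E_\delta(X)$, $\hat E_{\gamma\sqcap\delta}(X)=\hat E_\gamma(X)\cap\hat E_\delta(X)$, $\hat E_{\gamma^*}(X)=$ lfp of $Y\mapsto X\cup\hat E_\gamma(Y)$, $\hat E_{\gamma^\times}(X)=$ gfp of $Y\mapsto X\cap\hat E_\gamma(Y)$, $\hat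 E_{\psi?}(X)=[\![\psi]\!]\cap X$, $\hat E_{\psi!}(X)=[\![\psi]\!]\cup X$. Monotone $\mu$-calculus $A ::= p \mid \neg p \mid x \mid A\lor A \mid A\land A \mid \langle g\rangle A \mid \langle g^d\rangle A \mid \mu x.A \mid \nu x.A$, interpreted over game models with assignments $h$ in the standard way, $[\![\langle g\rangle A]\!]_h=E(g)([\![A]\!]_h)$, $[\![\langle g^d\rangle A]\!]_h=S\setminus E(g)(S\setminus[\![A]\!]_h)$, $\mu,\nu$ as least/greatest fixpoints; sentences have assignment-independent meaning. Fixpoint formulas are those of form $\langle\gamma^*\rangle\varphi$ or $\langle\gamma^\times\rangle\varphi$, each $\theta$ of these has a distinct variable $x^\theta$. Translation: $p^\sharp=p$, $(\neg p)^\sharp=\neg p$, $(\varphi\land\psi)^\sharp=\varphi^\sharp\land\psi^\sharp$, $(\varphi\lor\psi)^\sharp=\varphi^\sharp\lor\psi^\sharp$, $(\langle\gamma\rangle\varphi)^\sharp=\tau^\varphi_\gamma(\varphi^\sharp)$ with $\tau^\varphi_g(A)=\langle g\rangle A$, $\tau^\varphi_{g^d}(A)=\langle g^d\rangle A$, $\tau^\varphi_{\gamma\sqcap\delta}(A)=\tau^\varphi_\gamma(A)\land\tau^\varphi_\delta(A)$, $\tau^\varphi_{\gamma\sqcup\delta}(A)=\tau^\varphi_\gamma(A)\lor\tau^\varphi_\delta(A)$, $\tau^\varphi_{\gamma^*}(A)=\mu x^{\langle\gamma^*\rangle\varphi}.\,A\lor\tau^{\langle\gamma^*\rangle\varphi}_\gamma(x^{\langle\gamma^*\rangle\varphi})$,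 $\tau^\varphi_{\gamma^\times}(A)=\nu x^{\langle\gamma^\times\rangle\varphi}.\,A\land\tau^{\langle\gamma^\times\rangle\varphi}_\gamma(x^{\langle\gamma^\times\rangle\varphi})$, $\tau^\varphi_{\gamma;\delta}(A)=\tau^{\langle\delta\rangle\varphi}_\gamma(\tau^\varphi_\delta(A))$, $\tau^\varphi_{\psi?}(A)=\psi^\sharp\land A$, $\tau^\varphi_{\psi!}(A)=\psi^\sharp\lor A$. -}

module Defs where

import Level
open import Level using (Lift)
open import Data.Product using (Σ; Σ-syntax; _×_; _,_)
open import Data.Sum using (_⊎_)
open import Relation.Binary.PropositionalEquality using (_≡_; _≢_)
open import Relation.Nullary using (¬_)

↑ : Set → Set₁
↑ A = Lift (Level.suc Level.zero) A

Sub : Set → Set₁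
Sub S = S → Set

module _ {S : Set} where

  infix 4 _⊆_ _≐_
  _⊆_ : Sub S → Sub S → Set
  X ⊆ Y = ∀ {s} → X s → Y s

  _≐_ : Sub S → Sub S → Set
  X ≐ Y = (X ⊆ Y) × (Y ⊆ X)

  _∪_ : Sub S → Sub S → Sub S
  (X ∪ Y) s = X s ⊎ Y s

  _∩_ : Sub S → Sub S → Sub S
  (X ∩ Y) s = X s × Y s

  ∁ : Sub S → Sub S
  ∁ X s = ¬ X s

  -- Relational reading of fixpoints: R Y W means "W is the value of the
  -- (monotone) operator at Y".  Z is a fixpoint / the least / greatest one.
  IsFix : (Sub S → Sub S → Set₁) → Sub S → Set₁
  IsFix R Y = Σ[ W ∈ Sub S ] (R Y W × ↑ (W ≐ Y))

  IsLfp : (Sub S → Sub S → Set₁) → Sub S → Set₁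
  IsLfp R Z = IsFix R Z × (∀ Y → IsFix R Y → ↑ (Z ⊆ Y))

  IsGfp : (Sub S → Sub S → Set₁) → Sub S → Set₁
  IsGfp R Z = IsFix R Z × (∀ Y → IsFix R Y → ↑ (Y ⊆ Z))

record GameModel (P₀ G₀ : Set) : Set₁ where
  field
    S     : Set
    E     : G₀ → Sub S → Sub S
    E-mono : ∀ g {X Y} → X ⊆ Y → E g X ⊆ E g Y
    V     : P₀ → Sub S

infixr 6 _∧_
infixr 5 _∨_
infixr 7 _⨾_
infixr 6 _⊓_
infixr 5 _⊔_

mutual
  data Form (P₀ G₀ : Set) : Set where
    atom  : P₀ → Form P₀ G₀
    natom : P₀ → Form P₀ G₀
    _∨_   : Form P₀ G₀ → Form P₀ G₀ → Form P₀ G₀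
    _∧_   : Form P₀ G₀ → Form P₀ G₀ → Form P₀ G₀
    ⟨_⟩_  : Prog P₀ G₀ → Form P₀ G₀ → Form P₀ G₀

  data Prog (P₀ G₀ : Set) : Set where
    game  : G₀ → Prog P₀ G₀
    dual  : G₀ → Prog P₀ G₀
    _⨾_   : Prog P₀ G₀ → Prog P₀ G₀ → Prog P₀ G₀
    _⊔_   : Prog P₀ G₀ → Prog P₀ G₀ → Prog P₀ G₀
    _⊓_   : Prog P₀ G₀ → Prog P₀ G₀ → Prog P₀ G₀
    star  : Prog P₀ G₀ → Prog P₀ G₀
    cross : Prog P₀ G₀ → Prog P₀ G₀
    test  : Form P₀ G₀ → Prog P₀ G₀
    chal  : Form P₀ G₀ → Prog P₀ G₀

-- Monotone μ-calculus; variables are named x^θ with θ a game formula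

data MForm (P₀ G₀ : Set) : Set where
  matom  : P₀ → MForm P₀ G₀
  mnatom : P₀ → MForm P₀ G₀
  var    : Form P₀ G₀ → MForm P₀ G₀
  _∨ᵐ_   : MForm P₀ G₀ → MForm P₀ G₀ → MForm P₀ G₀
  _∧ᵐ_   : MForm P₀ G₀ → MForm P₀ G₀ → MForm P₀ G₀
  dia    : G₀ → MForm P₀ G₀ → MForm P₀ G₀
  ddia   : G₀ → MForm P₀ G₀ → MForm P₀ G₀
  μ      : Form P₀ G₀ → MForm P₀ G₀ → MForm P₀ G₀
  ν      : Form P₀ G₀ → MForm P₀ G₀ → MForm P₀ G₀

module _ {P₀ G₀ : Set} where

  mutual
    _♯ : Form P₀ G₀ → MForm P₀ G₀
    atom p ♯  = matom p
    natom p ♯ = mnatom p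
    (φ ∧ ψ) ♯ = (φ ♯) ∧ᵐ (ψ ♯)
    (φ ∨ ψ) ♯ = (φ ♯) ∨ᵐ (ψ ♯)
    (⟨ γ ⟩ φ) ♯ = τ φ γ (φ ♯)

    τ : Form P₀ G₀ → Prog P₀ G₀ → MForm P₀ G₀ → MForm P₀ G₀
    τ φ (game g) A  = dia g A
    τ φ (dual g) A  = ddia g A
    τ φ (γ ⊓ δ) A   = τ φ γ A ∧ᵐ τ φ δ A
    τ φ (γ ⊔ δ) A   = τ φ γ A ∨ᵐ τ φ δ A
    τ φ (star γ) A  = μ (⟨ star γ ⟩ φ) (A ∨ᵐ τ (⟨ star γ ⟩ φ) γ (var (⟨ star γ ⟩ φ)))
    τ φ (cross γ) A = ν (⟨ cross γ ⟩ φ) (A ∧ᵐ τ (⟨ cross γ ⟩ φ) γ (var (⟨ cross γ ⟩ φ)))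
    τ φ (γ ⨾ δ) A   = τ (⟨ δ ⟩ φ) γ (τ φ δ A)
    τ φ (test ψ) A  = (ψ ♯) ∧ᵐ A
    τ φ (chal ψ) A  = (ψ ♯) ∨ᵐ A

-- Semantics (relational: "Z is the denotation")

module Semantics {P₀ G₀ : Set} (M : GameModel P₀ G₀) where
  open GameModel M

  mutual
    ⟦_⟧≔_ : Form P₀ G₀ → Sub S → Set₁
    ⟦ atom p ⟧≔ Z  = ↑ (Z ≐ V p)
    ⟦ natom p ⟧≔ Z = ↑ (Z ≐ ∁ (V p))
    ⟦ φ ∨ ψ ⟧≔ Z   = Σ[ X ∈ Sub S ] Σ[ Y ∈ Sub S ] (⟦ φ ⟧≔ X × ⟦ ψ ⟧≔ Y × ↑ (Z ≐ X ∪ Y))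
    ⟦ φ ∧ ψ ⟧≔ Z   = Σ[ X ∈ Sub S ] Σ[ Y ∈ Sub S ] (⟦ φ ⟧≔ X × ⟦ ψ ⟧≔ Y × ↑ (Z ≐ X ∩ Y))
    ⟦ ⟨ γ ⟩ φ ⟧≔ Z = Σ[ X ∈ Sub S ] (⟦ φ ⟧≔ X × Ê γ X Z)

    Ê : Prog P₀ G₀ → Sub S → Sub S → Set₁
    Ê (game g) X Z  = ↑ (Z ≐ E g X)
    Ê (dual g) X Z  = ↑ (Z ≐ ∁ (E g (∁ X)))
    Ê (γ ⨾ δ) X Z   = Σ[ Y ∈ Sub S ] (Ê δ X Y × Ê γ Y Z)
    Ê (γ ⊔ δ) X Z   = Σ[ Y₁ ∈ Sub S ] Σ[ Y₂ ∈ Sub S ] (Ê γ X Y₁ × Ê δ X Y₂ × ↑ (Z ≐ Y₁ ∪ Y₂))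
    Ê (γ ⊓ δ) X Z   = Σ[ Y₁ ∈ Sub S ] Σ[ Y₂ ∈ Sub S ] (Ê γ X Y₁ × Ê δ X Y₂ × ↑ (Z ≐ Y₁ ∩ Y₂))
    Ê (star γ) X Z  = IsLfp (λ Y W → Σ[ U ∈ Sub S ] (Ê γ Y U × ↑ (W ≐ X ∪ U))) Z
    Ê (cross γ) X Z = IsGfp (λ Y W → Σ[ U ∈ Sub S ] (Ê γ Y U × ↑ (W ≐ X ∩ U))) Z
    Ê (test ψ) X Z  = Σ[ Y ∈ Sub S ] (⟦ ψ ⟧≔ Y × ↑ (Z ≐ Y ∩ X))
    Ê (chal ψ) X Z  = Σ[ Y ∈ Sub S ] (⟦ ψ ⟧≔ Y × ↑ (Z ≐ Y ∪ X))

  Assignment : Set₁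
  Assignment = Form P₀ G₀ → Sub S

  _[_↦_] : Assignment → Form P₀ G₀ → Sub S → Assignment
  (h [ x ↦ Y ]) z s = (z ≡ x × Y s) ⊎ (z ≢ x × h z s)

  ⟦_⟧ᵐ_≔_ : MForm P₀ G₀ → Assignment → Sub S → Set₁
  ⟦ matom p ⟧ᵐ h ≔ Z  = ↑ (Z ≐ V p)
  ⟦ mnatom p ⟧ᵐ h ≔ Z = ↑ (Z ≐ ∁ (V p))
  ⟦ var x ⟧ᵐ h ≔ Z    = ↑ (Z ≐ h x)
  ⟦ A ∨ᵐ B ⟧ᵐ h ≔ Z   = Σ[ X ∈ Sub S ] Σ[ Y ∈ Sub S ] (⟦ A ⟧ᵐ h ≔ X × ⟦ B ⟧ᵐ h ≔ Y × ↑ (Z ≐ X ∪ Y))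
  ⟦ A ∧ᵐ B ⟧ᵐ h ≔ Z   = Σ[ X ∈ Sub S ] Σ[ Y ∈ Sub S ] (⟦ A ⟧ᵐ h ≔ X × ⟦ B ⟧ᵐ h ≔ Y × ↑ (Z ≐ X ∩ Y))
  ⟦ dia g A ⟧ᵐ h ≔ Z  = Σ[ X ∈ Sub S ] (⟦ A ⟧ᵐ h ≔ X × ↑ (Z ≐ E g X))
  ⟦ ddia g A ⟧ᵐ h ≔ Z = Σ[ X ∈ Sub S ] (⟦ A ⟧ᵐ h ≔ X × ↑ (Z ≐ ∁ (E g (∁ X))))
  ⟦ μ x A ⟧ᵐ h ≔ Z    = IsLfp (λ Y W → ⟦ A ⟧ᵐ (h [ x ↦ Y ]) ≔ W) Z
  ⟦ ν x A ⟧ᵐ h ≔ Z    = IsGfp (λ Y W → ⟦ A ⟧ᵐ (h [ x ↦ Y ]) ≔ W) Z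

-- The translation is proved correct together with an invariant on τ: if the
-- meaning of A depends only on variables x^θ with depth θ ≤ depth φ, then
-- ⟦τ^φ_γ(A)⟧_h is the image of ⟦A⟧_h under Ê_γ.  Induction on γ; sequential
-- composition replaces φ by ⟨δ⟩φ, hence the invariant is graded by depth.  For
-- γ* and γ^× the bound variable x^⟨γ*⟩φ is deeper than every variable A reads,
-- so the μ-body A ∨ τ(x) denotes the operator Y ↦ X ∪ Ê_γ(Y) of the game
-- semantics (dually for ν), and the fixpoints coincide.  Since both semantics are
-- relational, every step also uses that denotations are unique up to ≐.

module Submission where

open import Defs
open import Data.Empty using (⊥-elim)
open import Data.Nat using (ℕ; suc; _≤_; _<_)
open import Data.Nat.Properties using (≤-refl; ≤-trans; n≤1+n; n<1+n; <⇒≱)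
open import Data.Product using (Σ-syntax; _×_; _,_; proj₁; proj₂)
open import Data.Sum using (inj₁; inj₂)
open import Function.Bundles using (_⇔_; mk⇔; Equivalence)
import Function.Properties.Equivalence as ⇔
open import Level using (lift; lower)
open import Relation.Binary.PropositionalEquality using (_≢_; refl)
open import Relation.Unary.Properties using (≐-refl; ≐-sym; ≐-trans)

open Equivalence using (to; from)

depth : {P₀ G₀ : Set} → Form P₀ G₀ → ℕ
depth (⟨ γ ⟩ φ) = suc (depth φ)
depth _         = 0

module _ {S : Set} where

  ∪-cong : {X X' Y Y' : Sub S} → X ≐ X' → Y ≐ Y' → X ∪ Y ≐ X' ∪ Y'
  ∪-cong (x⊆ , x⊇) (y⊆ , y⊇) =
    (λ { (inj₁ x) → inj₁ (x⊆ x) ; (inj₂ y) → inj₂ (y⊆ y) }) ,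
    (λ { (inj₁ x) → inj₁ (x⊇ x) ; (inj₂ y) → inj₂ (y⊇ y) })

  ∩-cong : {X X' Y Y' : Sub S} → X ≐ X' → Y ≐ Y' → X ∩ Y ≐ X' ∩ Y'
  ∩-cong (x⊆ , x⊇) (y⊆ , y⊇) = (λ (x , y) → x⊆ x , y⊆ y) , (λ (x , y) → x⊇ x , y⊇ y)

  ∁-cong : {X X' : Sub S} → X ≐ X' → ∁ X ≐ ∁ X'
  ∁-cong (x⊆ , x⊇) = (λ ¬x x' → ¬x (x⊇ x')) , (λ ¬x' x → ¬x' (x⊆ x))

  Functional : (Sub S → Set₁) → Set₁
  Functional P = ∀ {X X'} → P X → P X' → X ≐ X'

  RespectsInput : (Sub S → Sub S → Set₁) → Set₁
  RespectsInput R = ∀ {X X' Z} → X ≐ X' → R X Z → R X' Z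

  IsFix-map : {R R' : Sub S → Sub S → Set₁} → (∀ Y W → R Y W → R' Y W) →
              ∀ Y → IsFix R Y → IsFix R' Y
  IsFix-map f Y (W , r , W≐Y) = W , f Y W r , W≐Y

  IsFix-resp : {R : Sub S → Sub S → Set₁} → RespectsInput R →
               ∀ {Y Y'} → Y ≐ Y' → IsFix R Y → IsFix R Y'
  IsFix-resp resp Y≐Y' (W , r , lift W≐Y) = W , resp Y≐Y' r , lift (≐-trans W≐Y Y≐Y')

  IsLfp-map : {R R' : Sub S → Sub S → Set₁} → (∀ Y W → R Y W → R' Y W) → (∀ Y W → R' Y W → R Y W) →
              ∀ {Z} → IsLfp R Z → IsLfp R' Z
  IsLfp-map f g {Z} (fix , least) = IsFix-map f Z fix , λ Y fix' → least Y (IsFix-map g Y fix')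

  IsGfp-map : {R R' : Sub S → Sub S → Set₁} → (∀ Y W → R Y W → R' Y W) → (∀ Y W → R' Y W → R Y W) →
              ∀ {Z} → IsGfp R Z → IsGfp R' Z
  IsGfp-map f g {Z} (fix , great) = IsFix-map f Z fix , λ Y fix' → great Y (IsFix-map g Y fix')

  IsLfp-⇔ : {R R' : Sub S → Sub S → Set₁} → (∀ Y W → R Y W ⇔ R' Y W) →
            ∀ Z → IsLfp R Z ⇔ IsLfp R' Z
  IsLfp-⇔ R⇔R' Z = mk⇔ (IsLfp-map (λ Y W → to (R⇔R' Y W)) (λ Y W → from (R⇔R' Y W)) {Z})
                       (IsLfp-map (λ Y W → from (R⇔R' Y W)) (λ Y W → to (R⇔R' Y W)) {Z})

  IsGfp-⇔ : {R R' : Sub S → Sub S → Set₁} → (∀ Y W → R Y W ⇔ R' Y W) →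
            ∀ Z → IsGfp R Z ⇔ IsGfp R' Z
  IsGfp-⇔ R⇔R' Z = mk⇔ (IsGfp-map (λ Y W → to (R⇔R' Y W)) (λ Y W → from (R⇔R' Y W)) {Z})
                       (IsGfp-map (λ Y W → from (R⇔R' Y W)) (λ Y W → to (R⇔R' Y W)) {Z})

  IsLfp-resp : {R : Sub S → Sub S → Set₁} → RespectsInput R →
               ∀ {Z Z'} → Z ≐ Z' → IsLfp R Z → IsLfp R Z'
  IsLfp-resp resp Z≐Z' (fix , least) =
    IsFix-resp resp Z≐Z' fix , λ Y fix' → lift (λ z' → lower (least Y fix') (proj₂ Z≐Z' z'))

  IsGfp-resp : {R : Sub S → Sub S → Set₁} → RespectsInput R →
               ∀ {Z Z'} → Z ≐ Z' → IsGfp R Z → IsGfp R Z'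
  IsGfp-resp resp Z≐Z' (fix , great) =
    IsFix-resp resp Z≐Z' fix , λ Y fix' → lift (λ y → proj₁ Z≐Z' (lower (great Y fix') y))

  IsLfp-functional : {R : Sub S → Sub S → Set₁} → Functional (IsLfp R)
  IsLfp-functional (fix , least) (fix' , least') = lower (least _ fix') , lower (least' _ fix)

  IsGfp-functional : {R : Sub S → Sub S → Set₁} → Functional (IsGfp R)
  IsGfp-functional (fix , great) (fix' , great') = lower (great' _ fix) , lower (great _ fix')

  -- ⟦ ⟨ γ ⟩ φ ⟧≔_ unfolds to Image (⟦ φ ⟧≔_) (Ê γ), and ∨, ∧ and their
  -- μ-calculus counterparts to Combine _∪_ and Combine _∩_.
  Image : (Sub S → Set₁) → (Sub S → Sub S → Set₁) → Sub S → Set₁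
  Image P R Z = Σ[ X ∈ Sub S ] (P X × R X Z)

  Combine : (Sub S → Sub S → Sub S) → (Sub S → Set₁) → (Sub S → Set₁) → Sub S → Set₁
  Combine _⊕_ P Q Z = Σ[ X ∈ Sub S ] Σ[ Y ∈ Sub S ] (P X × Q Y × ↑ (Z ≐ X ⊕ Y))

  module _ {P : Sub S → Set₁} where

    Image-cong : {P' : Sub S → Set₁} {R : Sub S → Sub S → Set₁} → (∀ X → P X ⇔ P' X) →
                 ∀ Z → Image P R Z ⇔ Image P' R Z
    Image-cong P⇔P' Z = mk⇔ (λ (X , p , r) → X , to (P⇔P' X) p , r)
                            (λ (X , p , r) → X , from (P⇔P' X) p , r)

    Image-assoc : {R R' : Sub S → Sub S → Set₁} →
                  ∀ Z → Image (Image P R) R' Z ⇔ Image P (λ X → Image (R X) R') Z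
    Image-assoc Z = mk⇔ (λ (Y , (X , p , r) , r') → X , p , Y , r , r')
                        (λ (X , p , Y , r , r') → Y , (X , p , r) , r')

    Combine-cong : {_⊕_ : Sub S → Sub S → Sub S} {P' Q Q' : Sub S → Set₁} →
                   (∀ X → P X ⇔ P' X) → (∀ Y → Q Y ⇔ Q' Y) →
                   ∀ Z → Combine _⊕_ P Q Z ⇔ Combine _⊕_ P' Q' Z
    Combine-cong P⇔P' Q⇔Q' Z =
      mk⇔ (λ (X , Y , p , q , e) → X , Y , to (P⇔P' X) p , to (Q⇔Q' Y) q , e)
          (λ (X , Y , p , q , e) → X , Y , from (P⇔P' X) p , from (Q⇔Q' Y) q , e)

    Image-Combine : {_⊕_ : Sub S → Sub S → Sub S} {R₁ R₂ : Sub S → Sub S → Set₁} →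
                    Functional P → RespectsInput R₂ →
                    ∀ Z → Combine _⊕_ (Image P R₁) (Image P R₂) Z ⇔ Image P (λ X → Combine _⊕_ (R₁ X) (R₂ X)) Z
    Image-Combine functional resp Z =
      mk⇔ (λ (Y₁ , Y₂ , (X₁ , p₁ , r₁) , (X₂ , p₂ , r₂) , e) →
             X₁ , p₁ , Y₁ , Y₂ , r₁ , resp (functional p₂ p₁) r₂ , e)
          (λ (X , p , Y₁ , Y₂ , r₁ , r₂ , e) → Y₁ , Y₂ , (X , p , r₁) , (X , p , r₂) , e)

    Combine-determinedˡ : {_⊕_ : Sub S → Sub S → Sub S} {Q : Sub S → Set₁} →
                          (∀ {X X' U} → X ≐ X' → X ⊕ U ≐ X' ⊕ U) → Functional P →
                          ∀ {X} → P X → ∀ W → Combine _⊕_ P Q W ⇔ (Σ[ U ∈ Sub S ] (Q U × ↑ (W ≐ X ⊕ U)))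
    Combine-determinedˡ ⊕-congˡ functional p W =
      mk⇔ (λ (X' , U , p' , q , lift e) → U , q , lift (≐-trans e (⊕-congˡ (functional p' p))))
          (λ (U , q , e) → _ , U , p , q , e)

  Image-singleton : {R : Sub S → Sub S → Set₁} → RespectsInput R →
                    ∀ Y Z → Image (λ X → ↑ (X ≐ Y)) R Z ⇔ R Y Z
  Image-singleton resp Y Z = mk⇔ (λ (X , lift X≐Y , r) → resp X≐Y r) (λ r → Y , lift ≐-refl , r)

  IsLfp-parametrised : {P : Sub S → Set₁} {R : Sub S → Sub S → Set₁} {R' : Sub S → Sub S → Sub S → Set₁} →
                       (∀ {X} → P X → ∀ Y W → R Y W ⇔ R' X Y W) → (∀ {Y W} → R Y W → Σ[ X ∈ Sub S ] P X) →
                       ∀ Z → IsLfp R Z ⇔ Image P (λ X → IsLfp (R' X)) Z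
  IsLfp-parametrised R⇔R' input Z =
    mk⇔ (λ lfp → let X , p = input (proj₁ (proj₂ (proj₁ lfp))) in X , p , to (IsLfp-⇔ (R⇔R' p) Z) lfp)
        (λ (X , p , lfp) → from (IsLfp-⇔ (R⇔R' p) Z) lfp)

  IsGfp-parametrised : {P : Sub S → Set₁} {R : Sub S → Sub S → Set₁} {R' : Sub S → Sub S → Sub S → Set₁} →
                       (∀ {X} → P X → ∀ Y W → R Y W ⇔ R' X Y W) → (∀ {Y W} → R Y W → Σ[ X ∈ Sub S ] P X) →
                       ∀ Z → IsGfp R Z ⇔ Image P (λ X → IsGfp (R' X)) Z
  IsGfp-parametrised R⇔R' input Z =
    mk⇔ (λ gfp → let X , p = input (proj₁ (proj₂ (proj₁ gfp))) in X , p , to (IsGfp-⇔ (R⇔R' p) Z) gfp)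
        (λ (X , p , gfp) → from (IsGfp-⇔ (R⇔R' p) Z) gfp)

module _ {P₀ G₀ : Set} (M : GameModel P₀ G₀) where
  open GameModel M
  open Semantics M

  E-cong : ∀ g {X X'} → X ≐ X' → E g X ≐ E g X'
  E-cong g (X⊆X' , X'⊆X) = E-mono g X⊆X' , E-mono g X'⊆X

  Ê-resp : ∀ γ {X X' Z Z'} → X ≐ X' → Z ≐ Z' → Ê γ X Z → Ê γ X' Z'
  Ê-resp (game g) X≐X' Z≐Z' (lift e) = lift (≐-trans (≐-sym Z≐Z') (≐-trans e (E-cong g X≐X')))
  Ê-resp (dual g) X≐X' Z≐Z' (lift e) =
    lift (≐-trans (≐-sym Z≐Z') (≐-trans e (∁-cong (E-cong g (∁-cong X≐X')))))
  Ê-resp (γ ⨾ δ) X≐X' Z≐Z' (Y , d , c) = Y , Ê-resp δ X≐X' ≐-refl d , Ê-resp γ ≐-refl Z≐Z' c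
  Ê-resp (γ ⊔ δ) X≐X' Z≐Z' (Y₁ , Y₂ , c , d , lift e) =
    Y₁ , Y₂ , Ê-resp γ X≐X' ≐-refl c , Ê-resp δ X≐X' ≐-refl d , lift (≐-trans (≐-sym Z≐Z') e)
  Ê-resp (γ ⊓ δ) X≐X' Z≐Z' (Y₁ , Y₂ , c , d , lift e) =
    Y₁ , Y₂ , Ê-resp γ X≐X' ≐-refl c , Ê-resp δ X≐X' ≐-refl d , lift (≐-trans (≐-sym Z≐Z') e)
  Ê-resp (star γ) X≐X' Z≐Z' lfp =
    IsLfp-resp (λ Y≐Y' (U , c , e) → U , Ê-resp γ Y≐Y' ≐-refl c , e) Z≐Z'
      (IsLfp-map (λ _ _ (U , c , lift e) → U , c , lift (≐-trans e (∪-cong X≐X' ≐-refl)))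
                 (λ _ _ (U , c , lift e) → U , c , lift (≐-trans e (∪-cong (≐-sym X≐X') ≐-refl))) lfp)
  Ê-resp (cross γ) X≐X' Z≐Z' gfp =
    IsGfp-resp (λ Y≐Y' (U , c , e) → U , Ê-resp γ Y≐Y' ≐-refl c , e) Z≐Z'
      (IsGfp-map (λ _ _ (U , c , lift e) → U , c , lift (≐-trans e (∩-cong X≐X' ≐-refl)))
                 (λ _ _ (U , c , lift e) → U , c , lift (≐-trans e (∩-cong (≐-sym X≐X') ≐-refl))) gfp)
  Ê-resp (test ψ) X≐X' Z≐Z' (Y , p , lift e) =
    Y , p , lift (≐-trans (≐-sym Z≐Z') (≐-trans e (∩-cong ≐-refl X≐X')))
  Ê-resp (chal ψ) X≐X' Z≐Z' (Y , p , lift e) =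
    Y , p , lift (≐-trans (≐-sym Z≐Z') (≐-trans e (∪-cong ≐-refl X≐X')))

  Ê-respˡ : ∀ γ → RespectsInput (Ê γ)
  Ê-respˡ γ {Z = Z} X≐X' = Ê-resp γ X≐X' (≐-refl {x = Z})

  ⟦⟧ᵐ-functional : ∀ A h → Functional (⟦ A ⟧ᵐ h ≔_)
  ⟦⟧ᵐ-functional (matom p) h (lift e) (lift e') = ≐-trans e (≐-sym e')
  ⟦⟧ᵐ-functional (mnatom p) h (lift e) (lift e') = ≐-trans e (≐-sym e')
  ⟦⟧ᵐ-functional (var x) h (lift e) (lift e') = ≐-trans e (≐-sym e')
  ⟦⟧ᵐ-functional (A ∨ᵐ B) h (_ , _ , a , b , lift e) (_ , _ , a' , b' , lift e') =
    ≐-trans e (≐-trans (∪-cong (⟦⟧ᵐ-functional A h a a') (⟦⟧ᵐ-functional B h b b')) (≐-sym e'))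
  ⟦⟧ᵐ-functional (A ∧ᵐ B) h (_ , _ , a , b , lift e) (_ , _ , a' , b' , lift e') =
    ≐-trans e (≐-trans (∩-cong (⟦⟧ᵐ-functional A h a a') (⟦⟧ᵐ-functional B h b b')) (≐-sym e'))
  ⟦⟧ᵐ-functional (dia g A) h (_ , a , lift e) (_ , a' , lift e') =
    ≐-trans e (≐-trans (E-cong g (⟦⟧ᵐ-functional A h a a')) (≐-sym e'))
  ⟦⟧ᵐ-functional (ddia g A) h (_ , a , lift e) (_ , a' , lift e') =
    ≐-trans e (≐-trans (∁-cong (E-cong g (∁-cong (⟦⟧ᵐ-functional A h a a')))) (≐-sym e'))
  ⟦⟧ᵐ-functional (μ x A) h = IsLfp-functional
  ⟦⟧ᵐ-functional (ν x A) h = IsGfp-functional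

  Agree : ℕ → Assignment → Assignment → Set
  Agree n h h' = ∀ x → depth x ≤ n → h x ≐ h' x

  Stable : ℕ → MForm P₀ G₀ → Set₁
  Stable n A = ∀ {h h'} → Agree n h h' → ∀ W → ⟦ A ⟧ᵐ h ≔ W ⇔ ⟦ A ⟧ᵐ h' ≔ W

  Agree-update : ∀ {n x} h Y → n < depth x → Agree n h (h [ x ↦ Y ])
  Agree-update {x = x} h Y n<x y y≤n =
    (λ v → inj₂ (y≢x , v)) , λ { (inj₁ (y≡x , _)) → ⊥-elim (y≢x y≡x) ; (inj₂ (_ , v)) → v }
    where
    y≢x : y ≢ x
    y≢x refl = <⇒≱ n<x y≤n

  Stable-mono : ∀ {m n A} → m ≤ n → Stable m A → Stable n A
  Stable-mono m≤n st agree = st (λ x x≤m → agree x (≤-trans x≤m m≤n))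

  var-stable : ∀ x → Stable (depth x) (var x)
  var-stable x agree W = mk⇔ (λ (lift e) → lift (≐-trans e (agree x ≤-refl)))
                             (λ (lift e) → lift (≐-trans e (≐-sym (agree x ≤-refl))))

  var-update : ∀ h x Y X → ⟦ var x ⟧ᵐ (h [ x ↦ Y ]) ≔ X ⇔ ↑ (X ≐ Y)
  var-update h x Y X = mk⇔ (λ (lift e) → lift (≐-trans e lookup)) (λ (lift e) → lift (≐-trans e (≐-sym lookup)))
    where
    lookup : (h [ x ↦ Y ]) x ≐ Y
    lookup = (λ { (inj₁ (_ , y)) → y ; (inj₂ (x≢x , _)) → ⊥-elim (x≢x refl) }) , (λ y → inj₁ (refl , y))

  loop-body-input : ∀ {n _⊕_ Q} θ A → Stable n A → n < depth θ → ∀ h {Y W} →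
                    Combine _⊕_ (⟦ A ⟧ᵐ (h [ θ ↦ Y ]) ≔_) Q W → Σ[ X ∈ Sub S ] (⟦ A ⟧ᵐ h ≔ X)
  loop-body-input θ A st n<θ h {Y} (X , _ , a , _) = X , from (st (Agree-update h Y n<θ) X) a

  mutual
    ♯-correct : ∀ ξ h Z → ⟦ ξ ⟧≔ Z ⇔ ⟦ ξ ♯ ⟧ᵐ h ≔ Z
    ♯-correct (atom p) h Z = ⇔.refl
    ♯-correct (natom p) h Z = ⇔.refl
    ♯-correct (φ ∨ ψ) h Z = Combine-cong (♯-correct φ h) (♯-correct ψ h) Z
    ♯-correct (φ ∧ ψ) h Z = Combine-cong (♯-correct φ h) (♯-correct ψ h) Z
    ♯-correct (⟨ γ ⟩ φ) h Z =
      ⇔.trans (Image-cong {R = Ê γ} (♯-correct φ h) Z) (⇔.sym (τ-correct γ φ (φ ♯) (♯-stable φ) h Z))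

    ♯-stable : ∀ φ {n} → Stable n (φ ♯)
    ♯-stable φ {h = h} {h'} _ W = ⇔.trans (⇔.sym (♯-correct φ h W)) (♯-correct φ h' W)

    τ-correct : ∀ γ φ A → Stable (depth φ) A → ∀ h Z → ⟦ τ φ γ A ⟧ᵐ h ≔ Z ⇔ Image (⟦ A ⟧ᵐ h ≔_) (Ê γ) Z
    τ-correct (game g) φ A st h Z = ⇔.refl
    τ-correct (dual g) φ A st h Z = ⇔.refl
    τ-correct (γ ⨾ δ) φ A st h Z =
      ⇔.trans (τ-correct γ (⟨ δ ⟩ φ) (τ φ δ A) (Stable-mono (n≤1+n _) (τ-stable δ φ A st)) h Z)
              (⇔.trans (Image-cong {R = Ê γ} (τ-correct δ φ A st h) Z) (Image-assoc {R = Ê δ} {R' = Ê γ} Z))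
    τ-correct (γ ⊔ δ) φ A st h Z =
      ⇔.trans (Combine-cong (τ-correct γ φ A st h) (τ-correct δ φ A st h) Z)
              (Image-Combine (⟦⟧ᵐ-functional A h) (Ê-respˡ δ) Z)
    τ-correct (γ ⊓ δ) φ A st h Z =
      ⇔.trans (Combine-cong (τ-correct γ φ A st h) (τ-correct δ φ A st h) Z)
              (Image-Combine (⟦⟧ᵐ-functional A h) (Ê-respˡ δ) Z)
    τ-correct (star γ) φ A st h Z =
      IsLfp-parametrised (loop-body-correct (λ e → ∪-cong e ≐-refl) γ (⟨ star γ ⟩ φ) A st (n<1+n _) h)
                         (loop-body-input (⟨ star γ ⟩ φ) A st (n<1+n _) h) Z
    τ-correct (cross γ) φ A st h Z =
      IsGfp-parametrised (loop-body-correct (λ e → ∩-cong e ≐-refl) γ (⟨ cross γ ⟩ φ) A st (n<1+n _) h)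
                         (loop-body-input (⟨ cross γ ⟩ φ) A st (n<1+n _) h) Z
    τ-correct (test ψ) φ A st h Z =
      mk⇔ (λ (P , X , p , a , e) → X , a , P , from (♯-correct ψ h P) p , e)
          (λ (X , a , P , p , e) → P , X , to (♯-correct ψ h P) p , a , e)
    τ-correct (chal ψ) φ A st h Z =
      mk⇔ (λ (P , X , p , a , e) → X , a , P , from (♯-correct ψ h P) p , e)
          (λ (X , a , P , p , e) → P , X , to (♯-correct ψ h P) p , a , e)

    τ-stable : ∀ δ φ A → Stable (depth φ) A → Stable (depth φ) (τ φ δ A)
    τ-stable δ φ A st {h} {h'} agree W =
      ⇔.trans (τ-correct δ φ A st h W)
              (⇔.trans (Image-cong {R = Ê δ} (st agree) W) (⇔.sym (τ-correct δ φ A st h' W)))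

    τ-var-correct : ∀ γ θ h Y U → ⟦ τ θ γ (var θ) ⟧ᵐ (h [ θ ↦ Y ]) ≔ U ⇔ Ê γ Y U
    τ-var-correct γ θ h Y U =
      ⇔.trans (τ-correct γ θ (var θ) (var-stable θ) (h [ θ ↦ Y ]) U)
              (⇔.trans (Image-cong {R = Ê γ} (var-update h θ Y) U) (Image-singleton {R = Ê γ} (Ê-respˡ γ) Y U))

    loop-body-correct : ∀ {n _⊕_} → (∀ {X X' U} → X ≐ X' → X ⊕ U ≐ X' ⊕ U) →
      ∀ γ θ A → Stable n A → n < depth θ → ∀ h {X} → ⟦ A ⟧ᵐ h ≔ X → ∀ Y W →
      Combine _⊕_ (⟦ A ⟧ᵐ (h [ θ ↦ Y ]) ≔_) (⟦ τ θ γ (var θ) ⟧ᵐ (h [ θ ↦ Y ]) ≔_) W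
        ⇔ (Σ[ U ∈ Sub S ] (Ê γ Y U × ↑ (W ≐ X ⊕ U)))
    loop-body-correct ⊕-congˡ γ θ A st n<θ h a Y W =
      ⇔.trans (Combine-cong (λ X → ⇔.sym (st (Agree-update h Y n<θ) X)) (τ-var-correct γ θ h Y) W)
              (Combine-determinedˡ ⊕-congˡ (⟦⟧ᵐ-functional A h) a W)

proposition5 : {P₀ G₀ : Set} (M : GameModel P₀ G₀) (ξ : Form P₀ G₀)
    (h : Semantics.Assignment M) (Z : Sub (GameModel.S M)) →
    (Semantics.⟦_⟧≔_ M ξ Z ⇔ Semantics.⟦_⟧ᵐ_≔_ M (ξ ♯) h Z)
proposition5 M ξ h Z = ♯-correct M ξ h Z
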